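{- Let $m \geq 1$ and $k \geq 2$ be integers, let $w$ be an $m$-weighting of a graph $G$, and let $A = \{a_1,\ldots,a_r\}$ and $B = \{b_1,\ldots,b_r\}$ be disjoint $r$-element subsets of $V(G)$ such that (1) $a_i b_i \in E(G)$ for each $i \in [r]$; (2) $a_ia_j, a_ib_j, a_jb_i \in E(G)$ for every $i, j \in [r]$ with $b_ib_j \in E(G)$; and (3) $N_G(b_i) \setminus \left(A \cup \{v \in V(G) : w(v) = 0\}\right) \subseteq N_G(a_i)$ for each $i \in [r]$. Let $w'$ be the $m$-weighting of $G$ defined by $w'(v) = 0$ if $v \in A$, $w'(b_i) = w(b_i) + w(a_i)$ for each $i \in [r]$, and $w'(v) = w(v)$ for all other $v \in V(G)$. Then $\pi_k(G(w')) \leq \pi_k(G(w))$.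
   Context: All graphs are simple. $\mathbb{N}_0 = \{0,1,2,\dots\}$, $[r] = \{1,\dots,r\}$. $N_G(v)$ denotes the set of neighbours of $v$ in $G$. For a graph $G$, a function $w: V(G) \to \mathbb{N}_0$ with $\sum_{v \in V(G)} w(v) = m$ is an $m$-weighting of $G$. $G(w)$ is the graph obtained from $G$ by replacing each vertex $v$ by a clique $K^v$ on $w(v)$ vertices and joining every vertex of $K^u$ to every vertex of $K^v$ whenever $uv \in E(G)$. $\pi_k(H)$ denotes the number of $k$-cliques of a graph $H$. -}

module Defs where

open import Data.Nat using (ℕ; zero; suc; _+_)
open import Data.Fin using (Fin; toℕ)
open import Data.Fin.Properties using () renaming (_≟_ to _≟ᶠ_)
open import Data.Nat.Properties using () renaming (_≟_ to _≟ⁿ_)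
open import Data.List using (List; []; _∷_; _++_; map; length; filter; concatMap; allFin)
open import Data.Nat.ListAction using (sum)
open import Data.Bool using (Bool; true; false; _∧_; _∨_; not; T)
open import Data.Product using (Σ; _,_)
open import Relation.Nullary.Decidable using (⌊_⌋; T?)
open import Relation.Binary.PropositionalEquality using (_≡_)

record Graph (n : ℕ) : Set where
  field
    adj    : Fin n → Fin n → Bool
    sym    : ∀ u v → adj u v ≡ adj v u
    irrefl : ∀ v → adj v v ≡ false
open Graph public

Edge : ∀ {n} → Graph n → Fin n → Fin n → Set
Edge G u v = T (adj G u v)

IsWeighting : ∀ {n} → Graph n → ℕ → (Fin n → ℕ) → Set
IsWeighting {n} G m w = sum (map w (allFin n)) ≡ m

-- All k-element sublists (= k-subsets when the list has no repetitions).
combinations : {A : Set} → ℕ → List A → List (List A)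
combinations zero    xs       = [] ∷ []
combinations (suc k) []       = []
combinations (suc k) (x ∷ xs) = map (x ∷_) (combinations k xs) ++ combinations (suc k) xs

allB : {A : Set} → (A → Bool) → List A → Bool
allB p []       = true
allB p (x ∷ xs) = p x ∧ allB p xs

pairwiseAdj : {A : Set} → (A → A → Bool) → List A → Bool
pairwiseAdj R []       = true
pairwiseAdj R (x ∷ xs) = allB (R x) xs ∧ pairwiseAdj R xs

cliqueCount : {A : Set} → (A → A → Bool) → ℕ → List A → ℕ
cliqueCount R k vs = length (filter (λ s → T? (pairwiseAdj R s)) (combinations k vs))

-- The blow-up G(w): vertex v is replaced by the clique K^v with vertex set {v} × Fin (w v).
BlowVertex : ∀ {n} → (Fin n → ℕ) → Set
BlowVertex {n} w = Σ (Fin n) (λ v → Fin (w v))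

blowVertices : ∀ {n} → (w : Fin n → ℕ) → List (BlowVertex w)
blowVertices {n} w = concatMap (λ v → map (λ i → (v , i)) (allFin (w v))) (allFin n)

blowAdj : ∀ {n} → Graph n → (w : Fin n → ℕ) → BlowVertex w → BlowVertex w → Bool
blowAdj G w (u , i) (v , j) =
  (⌊ u ≟ᶠ v ⌋ ∧ not ⌊ toℕ i ≟ⁿ toℕ j ⌋) ∨ adj G u v

πBlowUp : ∀ {n} → ℕ → Graph n → (Fin n → ℕ) → ℕ
πBlowUp k G w = cliqueCount (blowAdj G w) k (blowVertices w)

{-# OPTIONS --safe #-}
module Submission where

-- Moving the weight of each a_i onto b_i yields an injective homomorphism G(w') → G(w): the
-- w(b_i) + w(a_i) copies of b_i in G(w') go to the w(b_i) copies of b_i and the w(a_i) copies of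
-- a_i in G(w), every other vertex is fixed, and conditions (1)–(3) are exactly what keeps
-- adjacent vertices adjacent. Such a map sends k-cliques to distinct k-cliques. To count them we
-- use the recursion "k-cliques through x are (k-1)-cliques in the neighbourhood of x", which is
-- invariant under permuting the vertex list and monotone in sublists and in the adjacency relation.

open import Defs hiding (sym)
open import Data.Bool using (Bool; true; false; _∧_; _∨_; not; T; if_then_else_)
open import Data.Bool.Properties using (∧-comm)
open import Data.Fin using (Fin; toℕ; fromℕ<)
open import Data.Fin.Properties using (any?; toℕ<n; toℕ-injective; toℕ-fromℕ<) renaming (_≟_ to _≟ᶠ_)
open import Data.List using (List; []; _∷_; _++_; map; length; filter; filterᵇ; allFin)
open import Data.List.Properties
  using (filter-++; filter-≐; filter-none; filter-accept; filter-reject; length-++; length-map)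
open import Data.List.Membership.Propositional using (_∈_)
open import Data.List.Membership.Propositional.Properties
  using (∈-filter⁺; ∈-filter⁻; ∈-map⁺; ∈-map⁻; ∈-concatMap⁺; ∈-allFin)
open import Data.List.Membership.Propositional.Properties.WithK using (unique∧set⇒bag)
import Data.List.Membership.DecPropositional as DecMembership
open import Data.List.Relation.Binary.BagAndSetEquality using (∼bag⇒↭)
open import Data.List.Relation.Binary.Disjoint.Propositional using (Disjoint)
open import Data.List.Relation.Binary.Permutation.Propositional using (_↭_; prep; swap)
import Data.List.Relation.Binary.Permutation.Propositional as ↭
open import Data.List.Relation.Binary.Permutation.Propositional.Properties using (filter-↭)
open import Data.List.Relation.Binary.Sublist.Propositional using (_⊆_; []; _∷_; _∷ʳ_; ⊆-refl)
open import Data.List.Relation.Binary.Sublist.Propositional.Properties using (filter⁺; filter-⊆)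
import Data.List.Relation.Unary.All as All
import Data.List.Relation.Unary.AllPairs as AllPairs
import Data.List.Relation.Unary.AllPairs.Properties as AllPairs
import Data.List.Relation.Unary.Any as Any
open import Data.List.Relation.Unary.Unique.Propositional using (Unique)
import Data.List.Relation.Unary.Unique.Propositional.Properties as Unique
open import Data.Nat using (ℕ; zero; suc; _+_; _∸_; _≤_; _<_; z≤n)
open import Data.Nat.Properties
  using (≤-refl; ≤-trans; m≤n+m; +-mono-≤; +-commutativeSemigroup; _<?_; n≮0; m<n⇒n≢0; ≮⇒≥; m+n∸m≡n; ∸-monoˡ-<; ∸-cancelʳ-≡;
         module ≤-Reasoning)
  renaming (_≟_ to _≟ⁿ_)
open import Algebra.Properties.CommutativeSemigroup +-commutativeSemigroup
  using (interchange; x∙yz≈y∙xz)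
open import Data.Product using (Σ; _×_; _,_; proj₁; proj₂)
open import Data.Product.Properties using (≡-dec)
open import Data.Sum using (_⊎_; inj₁; inj₂)
open import Data.Unit using (tt)
open import Function using (_∘_; id)
open import Function.Bundles using (mk⇔)
open import Function.Definitions using (Injective)
open import Relation.Binary.Definitions using (DecidableEquality)
open import Relation.Binary.PropositionalEquality
  using (_≡_; _≢_; refl; sym; trans; cong; cong₂; subst; module ≡-Reasoning)
open import Relation.Nullary using (yes; no; ¬_; contradiction)
open import Relation.Nullary.Decidable using (⌊_⌋; T?)

private variable A B : Set

filterᵇ-map : ∀ (f : A → B) p xs → filterᵇ p (map f xs) ≡ map f (filterᵇ (λ x → p (f x)) xs)
filterᵇ-map f p [] = refl
filterᵇ-map f p (x ∷ xs) with p (f x)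
... | true  = cong (f x ∷_) (filterᵇ-map f p xs)
... | false = filterᵇ-map f p xs

filterᵇ-∧ : ∀ (p q : A → Bool) xs → filterᵇ q (filterᵇ p xs) ≡ filterᵇ (λ x → p x ∧ q x) xs
filterᵇ-∧ p q [] = refl
filterᵇ-∧ p q (x ∷ xs) with p x
... | false = filterᵇ-∧ p q xs
... | true with q x
...   | true  = cong (x ∷_) (filterᵇ-∧ p q xs)
...   | false = filterᵇ-∧ p q xs

filterᵇ-comm : ∀ (p q : A → Bool) xs → filterᵇ q (filterᵇ p xs) ≡ filterᵇ p (filterᵇ q xs)
filterᵇ-comm p q xs = begin
  filterᵇ q (filterᵇ p xs)    ≡⟨ filterᵇ-∧ p q xs ⟩
  filterᵇ (λ y → p y ∧ q y) xs ≡⟨ filter-≐ _ _ (∧-comm-≐ p q , ∧-comm-≐ q p) xs ⟩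
  filterᵇ (λ y → q y ∧ p y) xs ≡⟨ sym (filterᵇ-∧ q p xs) ⟩
  filterᵇ p (filterᵇ q xs) ∎
  where
  open ≡-Reasoning
  ∧-comm-≐ : ∀ (p q : A → Bool) {y} → T (p y ∧ q y) → T (q y ∧ p y)
  ∧-comm-≐ p q {y} = subst T (∧-comm (p y) (q y))

filterᵇ-const-∧ : ∀ b (q : A → Bool) xs → filterᵇ (λ x → b ∧ q x) xs ≡ (if b then filterᵇ q xs else [])
filterᵇ-const-∧ true  q xs = refl
filterᵇ-const-∧ false q xs = filter-none (T? ∘ λ _ → false) (All.universal (λ _ ()) xs)

combinations-filterᵇ : ∀ (p : A → Bool) k xs →
  filterᵇ (allB p) (combinations k xs) ≡ combinations k (filterᵇ p xs)
combinations-filterᵇ p zero    xs       = refl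
combinations-filterᵇ p (suc k) []       = refl
combinations-filterᵇ p (suc k) (x ∷ xs) = begin
  filterᵇ (allB p) (map (x ∷_) C ++ D)
    ≡⟨ filter-++ (T? ∘ allB p) (map (x ∷_) C) D ⟩
  filterᵇ (allB p) (map (x ∷_) C) ++ filterᵇ (allB p) D
    ≡⟨ cong₂ _++_ (filterᵇ-map (x ∷_) (allB p) C) (combinations-filterᵇ p (suc k) xs) ⟩
  map (x ∷_) (filterᵇ (λ s → p x ∧ allB p s) C) ++ combinations (suc k) (filterᵇ p xs)
    ≡⟨ cong (λ ys → map (x ∷_) ys ++ _) (filterᵇ-const-∧ (p x) (allB p) C) ⟩
  map (x ∷_) (if p x then filterᵇ (allB p) C else []) ++ combinations (suc k) (filterᵇ p xs)
    ≡⟨ keep-or-drop-x ⟩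
  combinations (suc k) (filterᵇ p (x ∷ xs)) ∎
  where
  open ≡-Reasoning
  C D : List (List _)
  C = combinations k xs
  D = combinations (suc k) xs
  keep-or-drop-x : map (x ∷_) (if p x then filterᵇ (allB p) C else []) ++ combinations (suc k) (filterᵇ p xs)
                 ≡ combinations (suc k) (filterᵇ p (x ∷ xs))
  keep-or-drop-x with p x
  ... | true  = cong (λ ys → map (x ∷_) ys ++ combinations (suc k) (filterᵇ p xs)) (combinations-filterᵇ p k xs)
  ... | false = refl

countCliques : (A → A → Bool) → ℕ → List A → ℕ
countCliques R zero    xs       = 1
countCliques R (suc k) []       = 0
countCliques R (suc k) (x ∷ xs) = countCliques R k (filterᵇ (R x) xs) + countCliques R (suc k) xs

cliqueCount≡countCliques : ∀ (R : A → A → Bool) k xs → cliqueCount R k xs ≡ countCliques R k xs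
cliqueCount≡countCliques R zero    xs       = refl
cliqueCount≡countCliques R (suc k) []       = refl
cliqueCount≡countCliques R (suc k) (x ∷ xs) = begin
  length (filterᵇ clique (map (x ∷_) C ++ D))
    ≡⟨ cong length (filter-++ (T? ∘ clique) (map (x ∷_) C) D) ⟩
  length (filterᵇ clique (map (x ∷_) C) ++ filterᵇ clique D)
    ≡⟨ length-++ (filterᵇ clique (map (x ∷_) C)) ⟩
  length (filterᵇ clique (map (x ∷_) C)) + cliqueCount R (suc k) xs
    ≡⟨ cong₂ _+_ cliques-through-x (cliqueCount≡countCliques R (suc k) xs) ⟩
  countCliques R k (filterᵇ (R x) xs) + countCliques R (suc k) xs ∎
  where
  open ≡-Reasoning
  clique : List _ → Bool
  clique = pairwiseAdj R
  C D : List (List _)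
  C = combinations k xs
  D = combinations (suc k) xs
  cliques-through-x : length (filterᵇ clique (map (x ∷_) C)) ≡ countCliques R k (filterᵇ (R x) xs)
  cliques-through-x = begin
    length (filterᵇ clique (map (x ∷_) C))
      ≡⟨ cong length (filterᵇ-map (x ∷_) clique C) ⟩
    length (map (x ∷_) (filterᵇ (λ s → allB (R x) s ∧ clique s) C))
      ≡⟨ length-map (x ∷_) (filterᵇ (λ s → allB (R x) s ∧ clique s) C) ⟩
    length (filterᵇ (λ s → allB (R x) s ∧ clique s) C)
      ≡⟨ cong length (sym (filterᵇ-∧ (allB (R x)) clique C)) ⟩
    length (filterᵇ clique (filterᵇ (allB (R x)) C))
      ≡⟨ cong (length ∘ filterᵇ clique) (combinations-filterᵇ (R x) k xs) ⟩
    cliqueCount R k (filterᵇ (R x) xs)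
      ≡⟨ cliqueCount≡countCliques R k (filterᵇ (R x) xs) ⟩
    countCliques R k (filterᵇ (R x) xs) ∎

countCliques-map : ∀ (S : B → B → Bool) (f : A → B) k xs →
  countCliques (λ x y → S (f x) (f y)) k xs ≡ countCliques S k (map f xs)
countCliques-map S f zero    xs       = refl
countCliques-map S f (suc k) []       = refl
countCliques-map S f (suc k) (x ∷ xs) = cong₂ _+_
  (trans (countCliques-map S f k _) (cong (countCliques S k) (sym (filterᵇ-map f (S (f x)) xs))))
  (countCliques-map S f (suc k) xs)

countCliques-⊆ : ∀ (R : A → A → Bool) k {xs ys} → xs ⊆ ys → countCliques R k xs ≤ countCliques R k ys
countCliques-⊆ R zero    _          = ≤-refl
countCliques-⊆ R (suc k) []         = z≤n
countCliques-⊆ R (suc k) (y ∷ʳ xs⊆ys) =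
  ≤-trans (countCliques-⊆ R (suc k) xs⊆ys) (m≤n+m _ _)
countCliques-⊆ R (suc k) (refl ∷ xs⊆ys) = +-mono-≤
  (countCliques-⊆ R k (filter⁺ _ _ (λ { refl → id }) xs⊆ys))
  (countCliques-⊆ R (suc k) xs⊆ys)

countCliques-mono : ∀ (R S : A → A → Bool) → (∀ x y → T (R x y) → T (S x y)) →
  ∀ k xs → countCliques R k xs ≤ countCliques S k xs
countCliques-mono R S R⇒S zero    xs       = ≤-refl
countCliques-mono R S R⇒S (suc k) []       = z≤n
countCliques-mono R S R⇒S (suc k) (x ∷ xs) = +-mono-≤
  (≤-trans (countCliques-mono R S R⇒S k (filterᵇ (R x) xs))
           (countCliques-⊆ S k (filter⁺ (T? ∘ R x) (T? ∘ S x) (λ { refl → R⇒S x _ }) (⊆-refl {x = xs}))))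
  (countCliques-mono R S R⇒S (suc k) xs)

module _ (R : A → A → Bool) (R-sym : ∀ x y → R x y ≡ R y x) where

  countCliques-swap : ∀ k x y xs → countCliques R k (x ∷ y ∷ xs) ≡ countCliques R k (y ∷ x ∷ xs)
  countCliques-swap zero          x y xs = refl
  countCliques-swap (suc zero)    x y xs = refl
  countCliques-swap (suc (suc k)) x y xs with T? (R x y)
  ... | yes xy = begin
    countCliques R (suc k) (filterᵇ (R x) (y ∷ xs)) + (Ny + N)
      ≡⟨ cong (λ zs → countCliques R (suc k) zs + (Ny + N)) (filter-accept (T? ∘ R x) xy) ⟩
    (countCliques R k (filterᵇ (R y) (filterᵇ (R x) xs)) + Nx) + (Ny + N)
      ≡⟨ cong (λ zs → (countCliques R k zs + Nx) + (Ny + N)) (filterᵇ-comm (R x) (R y) xs) ⟩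
    (Nxy + Nx) + (Ny + N)
      ≡⟨ interchange Nxy Nx Ny N ⟩
    (Nxy + Ny) + (Nx + N)
      ≡⟨ cong (λ zs → countCliques R (suc k) zs + (Nx + N)) (sym (filter-accept (T? ∘ R y) yx)) ⟩
    countCliques R (suc k) (filterᵇ (R y) (x ∷ xs)) + (Nx + N) ∎
    where
    open ≡-Reasoning
    yx : T (R y x)
    yx = subst T (R-sym x y) xy
    Nx Ny Nxy N : ℕ
    Nx = countCliques R (suc k) (filterᵇ (R x) xs)
    Ny = countCliques R (suc k) (filterᵇ (R y) xs)
    Nxy = countCliques R k (filterᵇ (R x) (filterᵇ (R y) xs))
    N = countCliques R (suc (suc k)) xs
  ... | no ¬xy = begin
    countCliques R (suc k) (filterᵇ (R x) (y ∷ xs)) + (Ny + N)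
      ≡⟨ cong (λ zs → countCliques R (suc k) zs + (Ny + N)) (filter-reject (T? ∘ R x) ¬xy) ⟩
    Nx + (Ny + N)
      ≡⟨ x∙yz≈y∙xz Nx Ny N ⟩
    Ny + (Nx + N)
      ≡⟨ cong (λ zs → countCliques R (suc k) zs + (Nx + N)) (sym (filter-reject (T? ∘ R y) ¬yx)) ⟩
    countCliques R (suc k) (filterᵇ (R y) (x ∷ xs)) + (Nx + N) ∎
    where
    open ≡-Reasoning
    ¬yx : ¬ T (R y x)
    ¬yx = ¬xy ∘ subst T (R-sym y x)
    Nx Ny N : ℕ
    Nx = countCliques R (suc k) (filterᵇ (R x) xs)
    Ny = countCliques R (suc k) (filterᵇ (R y) xs)
    N = countCliques R (suc (suc k)) xs

  countCliques-↭ : ∀ k {xs ys} → xs ↭ ys → countCliques R k xs ≡ countCliques R k ys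
  countCliques-↭ zero    _            = refl
  countCliques-↭ (suc k) ↭.refl        = refl
  countCliques-↭ (suc k) (prep x p)   =
    cong₂ _+_ (countCliques-↭ k (filter-↭ (T? ∘ R x) p)) (countCliques-↭ (suc k) p)
  countCliques-↭ (suc k) (swap x y p) = trans (countCliques-swap (suc k) x y _)
    (cong₂ _+_ (countCliques-↭ k (filter-↭ (T? ∘ R y) (prep x p)))
      (cong₂ _+_ (countCliques-↭ k (filter-↭ (T? ∘ R x) p)) (countCliques-↭ (suc k) p)))
  countCliques-↭ (suc k) (↭.trans p q) = trans (countCliques-↭ (suc k) p) (countCliques-↭ (suc k) q)

module _ (_≟_ : DecidableEquality A) where

  open DecMembership _≟_ using (_∈?_)

  unique-⊆⇒↭-sublist : ∀ {xs ys : List A} → Unique xs → Unique ys → (∀ {x} → x ∈ xs → x ∈ ys) →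
    Σ (List A) λ zs → xs ↭ zs × zs ⊆ ys
  unique-⊆⇒↭-sublist {xs} {ys} xs! ys! xs⊆ys =
    zs , ∼bag⇒↭ (unique∧set⇒bag xs! (Unique.filter⁺ (_∈? xs) ys!) (mk⇔ to from)) , filter-⊆ (_∈? xs) ys
    where
    zs : List A
    zs = filter (_∈? xs) ys
    to : ∀ {x} → x ∈ xs → x ∈ zs
    to x∈xs = ∈-filter⁺ (_∈? xs) (xs⊆ys x∈xs) x∈xs
    from : ∀ {x} → x ∈ zs → x ∈ xs
    from x∈zs = proj₂ (∈-filter⁻ (_∈? xs) {xs = ys} x∈zs)

countCliques-≤-embedding : ∀ (R : A → A → Bool) (S : B → B → Bool) → DecidableEquality B →
  (∀ x y → S x y ≡ S y x) → (f : A → B) → Injective _≡_ _≡_ f →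
  (∀ x y → T (R x y) → T (S (f x) (f y))) →
  ∀ {xs ys} → Unique xs → Unique ys → (∀ {x} → x ∈ xs → f x ∈ ys) →
  ∀ k → countCliques R k xs ≤ countCliques S k ys
countCliques-≤-embedding R S _≟_ S-sym f f-inj hom {xs} {ys} xs! ys! f[xs]⊆ys k =
  let zs , f[xs]↭zs , zs⊆ys = unique-⊆⇒↭-sublist _≟_ (Unique.map⁺ f-inj xs!) ys! map-f⊆ys in begin
  countCliques R k xs                       ≤⟨ countCliques-mono R (λ x y → S (f x) (f y)) hom k xs ⟩
  countCliques (λ x y → S (f x) (f y)) k xs ≡⟨ countCliques-map S f k xs ⟩
  countCliques S k (map f xs)               ≡⟨ countCliques-↭ S S-sym k f[xs]↭zs ⟩
  countCliques S k zs                       ≤⟨ countCliques-⊆ S k zs⊆ys ⟩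
  countCliques S k ys                       ∎
  where
  open ≤-Reasoning
  map-f⊆ys : ∀ {y} → y ∈ map f xs → y ∈ ys
  map-f⊆ys y∈ with x , x∈xs , refl ← ∈-map⁻ f y∈ = f[xs]⊆ys x∈xs

⌊≟⌋-sym : (_≟_ : DecidableEquality A) → ∀ x y → ⌊ x ≟ y ⌋ ≡ ⌊ y ≟ x ⌋
⌊≟⌋-sym _≟_ x y with x ≟ y | y ≟ x
... | yes _   | yes _   = refl
... | no  _   | no  _   = refl
... | yes x≡y | no  y≢x = contradiction (sym x≡y) y≢x
... | no  x≢y | yes y≡x = contradiction (sym y≡x) x≢y

-- Both blow-ups are viewed inside Fin n × ℕ, (v , i) standing for the i-th copy of v, so that one
-- vertex map can relate G(w') and G(w); Valid w picks out the vertices of G(w).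
module _ {n : ℕ} where

  Point : Set
  Point = Fin n × ℕ

  encode : {w : Fin n → ℕ} → BlowVertex w → Point
  encode (v , i) = v , toℕ i

  Valid : (Fin n → ℕ) → Point → Set
  Valid w (v , i) = i < w v

  adjℕ : Graph n → Point → Point → Bool
  adjℕ G (u , i) (v , j) = (⌊ u ≟ᶠ v ⌋ ∧ not ⌊ i ≟ⁿ j ⌋) ∨ adj G u v

  adjℕ-sym : ∀ G x y → adjℕ G x y ≡ adjℕ G y x
  adjℕ-sym G (u , i) (v , j)
    rewrite ⌊≟⌋-sym _≟ᶠ_ u v | ⌊≟⌋-sym _≟ⁿ_ i j | Graph.sym G u v = refl

  adjℕ⇒≡⊎edge : ∀ G {u v i j} → T (adjℕ G (u , i) (v , j)) → (u ≡ v × i ≢ j) ⊎ Edge G u v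
  adjℕ⇒≡⊎edge G {u} {v} {i} {j} h with u ≟ᶠ v | i ≟ⁿ j | adj G u v
  ... | _        | _        | true  = inj₂ tt
  ... | yes u≡v  | no  i≢j  | false = inj₁ (u≡v , i≢j)

  edge⇒adjℕ : ∀ G {u v i j} → Edge G u v → T (adjℕ G (u , i) (v , j))
  edge⇒adjℕ G {u} {v} {i} {j} e with ⌊ u ≟ᶠ v ⌋ ∧ not ⌊ i ≟ⁿ j ⌋
  ... | true  = tt
  ... | false = e

  ≢⇒adjℕ : ∀ G {v i j} → i ≢ j → T (adjℕ G (v , i) (v , j))
  ≢⇒adjℕ G {v} {i} {j} i≢j with v ≟ᶠ v | i ≟ⁿ j
  ... | yes _   | no _    = tt
  ... | yes _   | yes i≡j = contradiction i≡j i≢j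
  ... | no  v≢v | _       = contradiction refl v≢v

  encode-injective : {w : Fin n → ℕ} → Injective _≡_ _≡_ (encode {w})
  encode-injective {x = v , i} {y = u , j} e with refl ← cong proj₁ e =
    cong (v ,_) (toℕ-injective (cong proj₂ e))

  ∈-blowVertices : {w : Fin n → ℕ} (x : BlowVertex w) → x ∈ blowVertices w
  ∈-blowVertices {w} (v , i) =
    ∈-concatMap⁺ (λ u → map (u ,_) (allFin (w u)))
      (Any.map (λ { refl → ∈-map⁺ (v ,_) (∈-allFin i) }) (∈-allFin v))

  Valid⇒∈ : ∀ {w x} → Valid w x → x ∈ map encode (blowVertices w)
  Valid⇒∈ {w} {v , i} i<wv =
    subst (λ j → (v , j) ∈ map encode (blowVertices w)) (toℕ-fromℕ< i<wv)
      (∈-map⁺ encode (∈-blowVertices (v , fromℕ< i<wv)))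

  blowVertices-unique : (w : Fin n → ℕ) → Unique (blowVertices w)
  blowVertices-unique w =
    Unique.concat⁺ (All.tabulate copies-unique) (AllPairs.map⁺ (AllPairs.map disjoint (Unique.allFin⁺ n)))
    where
    copies : Fin n → List (BlowVertex w)
    copies v = map (v ,_) (allFin (w v))
    copies-unique : ∀ {xs} → xs ∈ map copies (allFin n) → Unique xs
    copies-unique xs∈ with v , _ , refl ← ∈-map⁻ copies xs∈ = Unique.map⁺ (λ { refl → refl }) (Unique.allFin⁺ (w v))
    base : ∀ {v x} → x ∈ copies v → proj₁ x ≡ v
    base x∈ with _ , _ , refl ← ∈-map⁻ _ x∈ = refl
    disjoint : ∀ {u v} → u ≢ v → Disjoint (copies u) (copies v)
    disjoint u≢v (x∈u , x∈v) = u≢v (trans (sym (base x∈u)) (base x∈v))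

πBlowUp≡countCliques : ∀ {n} (G : Graph n) w k → πBlowUp k G w ≡ countCliques (adjℕ G) k (map encode (blowVertices w))
πBlowUp≡countCliques G w k =
  trans (cliqueCount≡countCliques (blowAdj G w) k (blowVertices w)) (countCliques-map (adjℕ G) encode k (blowVertices w))

πBlowUp-≤ : ∀ {n} (G : Graph n) (w w' : Fin n → ℕ) (h : Point → Point) →
  (∀ (x : BlowVertex w') → Valid w (h (encode x))) →
  Injective _≡_ _≡_ (h ∘ encode {w = w'}) →
  (∀ x y → T (blowAdj G w' x y) → T (adjℕ G (h (encode x)) (h (encode y)))) →
  ∀ k → πBlowUp k G w' ≤ πBlowUp k G w
πBlowUp-≤ G w w' h h-valid h-inj h-hom k = begin
  πBlowUp k G w'
    ≡⟨ cliqueCount≡countCliques (blowAdj G w') k (blowVertices w') ⟩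
  countCliques (blowAdj G w') k (blowVertices w')
    ≤⟨ countCliques-≤-embedding (blowAdj G w') (adjℕ G) (≡-dec _≟ᶠ_ _≟ⁿ_) (adjℕ-sym G) (h ∘ encode) h-inj h-hom
         (blowVertices-unique w') (Unique.map⁺ encode-injective (blowVertices-unique w)) (λ {x} _ → Valid⇒∈ (h-valid x)) k ⟩
  countCliques (adjℕ G) k (map encode (blowVertices w))
    ≡⟨ sym (πBlowUp≡countCliques G w k) ⟩
  πBlowUp k G w ∎
  where open ≤-Reasoning

module Shift {n r : ℕ} (G : Graph n) (w w' : Fin n → ℕ) (a b : Fin r → Fin n)
  (a-inj : Injective _≡_ _≡_ a) (b-inj : Injective _≡_ _≡_ b) (a≢b : ∀ i j → a i ≢ b j)
  (ab-edge : ∀ i → Edge G (a i) (b i))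
  (bb-edge : ∀ i j → Edge G (b i) (b j) → Edge G (a i) (a j) × Edge G (a i) (b j) × Edge G (a j) (b i))
  (b-nbr⇒a-nbr : ∀ i v → Edge G (b i) v → (∀ j → v ≢ a j) → w v ≢ 0 → Edge G (a i) v)
  (w'-a : ∀ i → w' (a i) ≡ 0)
  (w'-b : ∀ i → w' (b i) ≡ w (b i) + w (a i))
  (w'-rest : ∀ v → (∀ i → v ≢ a i) → (∀ i → v ≢ b i) → w' v ≡ w v) where

  shift : Point → Point
  shift (v , i) with any? (λ j → b j ≟ᶠ v)
  ... | no _        = v , i
  ... | yes (j , _) with i <? w (b j)
  ...   | yes _ = b j , i
  ...   | no  _ = a j , i ∸ w (b j)

  data ShiftCase : Fin n → ℕ → Point → Set where
    fixed : ∀ {v i} → (∀ j → v ≢ a j) → (∀ j → v ≢ b j) → i < w v → ShiftCase v i (v , i)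
    to-b  : ∀ {i} j → i < w (b j) → ShiftCase (b j) i (b j , i)
    to-a  : ∀ {i} j → w (b j) ≤ i → i ∸ w (b j) < w (a j) → ShiftCase (b j) i (a j , i ∸ w (b j))

  shift-case : ∀ {v i} → i < w' v → ShiftCase v i (shift (v , i))
  shift-case {v} {i} i<w'v with any? (λ j → b j ≟ᶠ v)
  ... | no ∄bj≡v = fixed v∉A v∉B (subst (i <_) (w'-rest v v∉A v∉B) i<w'v)
    where
    v∉A : ∀ j → v ≢ a j
    v∉A j refl = n≮0 (subst (i <_) (w'-a j) i<w'v)
    v∉B : ∀ j → v ≢ b j
    v∉B j v≡bj = ∄bj≡v (j , sym v≡bj)
  ... | yes (j , refl) with i <? w (b j)
  ...   | yes i<wb = to-b j i<wb
  ...   | no  i≮wb = to-a j wb≤i (subst (i ∸ w (b j) <_) (m+n∸m≡n (w (b j)) (w (a j)))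
                                    (∸-monoˡ-< (subst (i <_) (w'-b j) i<w'v) wb≤i))
    where
    wb≤i : w (b j) ≤ i
    wb≤i = ≮⇒≥ i≮wb

  shift-valid : ∀ {v i p} → ShiftCase v i p → Valid w p
  shift-valid (fixed _ _ i<wv)  = i<wv
  shift-valid (to-b _ i<wb)     = i<wb
  shift-valid (to-a _ _ i∸wb<wa) = i∸wb<wa

  shift-injective : ∀ {v i u j p q} → ShiftCase v i p → ShiftCase u j q → p ≡ q → (v , i) ≡ (u , j)
  shift-injective (fixed _ _ _)   (fixed _ _ _)    p≡q = p≡q
  shift-injective (fixed _ v∉B _) (to-b j' _)      p≡q = contradiction (cong proj₁ p≡q) (v∉B j')
  shift-injective (fixed v∉A _ _) (to-a j' _ _)    p≡q = contradiction (cong proj₁ p≡q) (v∉A j')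
  shift-injective (to-b j _)      (fixed _ u∉B _)  p≡q = contradiction (sym (cong proj₁ p≡q)) (u∉B j)
  shift-injective (to-a j _ _)    (fixed u∉A _ _)  p≡q = contradiction (sym (cong proj₁ p≡q)) (u∉A j)
  shift-injective (to-b _ _)      (to-b _ _)       p≡q = p≡q
  shift-injective (to-b j _)      (to-a j' _ _)    p≡q = contradiction (sym (cong proj₁ p≡q)) (a≢b j' j)
  shift-injective (to-a j _ _)    (to-b j' _)      p≡q = contradiction (cong proj₁ p≡q) (a≢b j j')
  shift-injective (to-a j wb≤i _) (to-a j' wb≤i' _) p≡q with refl ← a-inj (cong proj₁ p≡q) =
    cong (b j ,_) (∸-cancelʳ-≡ wb≤i wb≤i' (cong proj₂ p≡q))

  edge-sym : ∀ {u v} → Edge G u v → Edge G v u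
  edge-sym {u} {v} = subst T (Graph.sym G u v)

  shift-adj : ∀ {v i u j p q} → ShiftCase v i p → ShiftCase u j q →
    T (adjℕ G (v , i) (u , j)) → T (adjℕ G p q)
  shift-adj (fixed _ _ _) (fixed _ _ _) x∼y = x∼y
  shift-adj (fixed _ _ _) (to-b _ _)    x∼y = x∼y
  shift-adj (to-b _ _)    (fixed _ _ _) x∼y = x∼y
  shift-adj (to-b _ _)    (to-b _ _)    x∼y = x∼y
  shift-adj (fixed v∉A v∉B i<wv) (to-a j _ _) x∼y with adjℕ⇒≡⊎edge G x∼y
  ... | inj₁ (v≡bj , _) = contradiction v≡bj (v∉B j)
  ... | inj₂ e          = edge⇒adjℕ G (edge-sym (b-nbr⇒a-nbr j _ (edge-sym e) v∉A (m<n⇒n≢0 i<wv)))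
  shift-adj (to-a j _ _) (fixed u∉A u∉B i<wu) x∼y with adjℕ⇒≡⊎edge G x∼y
  ... | inj₁ (bj≡u , _) = contradiction (sym bj≡u) (u∉B j)
  ... | inj₂ e          = edge⇒adjℕ G (b-nbr⇒a-nbr j _ e u∉A (m<n⇒n≢0 i<wu))
  shift-adj (to-b j _) (to-a j' _ _) x∼y with adjℕ⇒≡⊎edge G x∼y
  ... | inj₁ (bj≡bj' , _) with refl ← b-inj bj≡bj' = edge⇒adjℕ G (edge-sym (ab-edge j))
  ... | inj₂ e          = edge⇒adjℕ G (edge-sym (proj₂ (proj₂ (bb-edge j j' e))))
  shift-adj (to-a j _ _) (to-b j' _) x∼y with adjℕ⇒≡⊎edge G x∼y
  ... | inj₁ (bj≡bj' , _) with refl ← b-inj bj≡bj' = edge⇒adjℕ G (ab-edge j)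
  ... | inj₂ e          = edge⇒adjℕ G (proj₁ (proj₂ (bb-edge j j' e)))
  shift-adj (to-a j wb≤i _) (to-a j' wb≤i' _) x∼y with adjℕ⇒≡⊎edge G x∼y
  ... | inj₁ (bj≡bj' , i≢i') with refl ← b-inj bj≡bj' = ≢⇒adjℕ G (i≢i' ∘ ∸-cancelʳ-≡ wb≤i wb≤i')
  ... | inj₂ e          = edge⇒adjℕ G (proj₁ (bb-edge j j' e))

  πBlowUp-shift-≤ : ∀ k → πBlowUp k G w' ≤ πBlowUp k G w
  πBlowUp-shift-≤ = πBlowUp-≤ G w w' shift
    (λ (v , i) → shift-valid (shift-case (toℕ<n i)))
    (λ {(v , i)} {(u , j)} p≡q →
      encode-injective (shift-injective (shift-case (toℕ<n i)) (shift-case (toℕ<n j)) p≡q))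
    (λ (v , i) (u , j) → shift-adj (shift-case (toℕ<n i)) (shift-case (toℕ<n j)))

-- The bound holds for every k and every weighting.
lemma4 : ∀ {n} (G : Graph n) (m k r : ℕ) (w w' : Fin n → ℕ)
  → 1 ≤ m → 2 ≤ k
  → IsWeighting G m w
  → (a b : Fin r → Fin n)
  → Injective _≡_ _≡_ a → Injective _≡_ _≡_ b
  → (∀ i j → a i ≢ b j)
  → (∀ i → Edge G (a i) (b i))
  → (∀ i j → Edge G (b i) (b j)
       → Edge G (a i) (a j) × Edge G (a i) (b j) × Edge G (a j) (b i))
  → (∀ i v → Edge G (b i) v → (∀ j → v ≢ a j) → w v ≢ 0 → Edge G (a i) v)
  → (∀ i → w' (a i) ≡ 0)
  → (∀ i → w' (b i) ≡ w (b i) + w (a i))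
  → (∀ v → (∀ i → v ≢ a i) → (∀ i → v ≢ b i) → w' v ≡ w v)
  → πBlowUp k G w' ≤ πBlowUp k G w
lemma4 G _ k r w w' _ _ _ a b a-inj b-inj a≢b ab-edge bb-edge b-nbr⇒a-nbr w'-a w'-b w'-rest =
  Shift.πBlowUp-shift-≤ G w w' a b a-inj b-inj a≢b ab-edge bb-edge b-nbr⇒a-nbr w'-a w'-b w'-rest k
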